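{- Let $F_{n;2}^{(I)}(x) = \sum_{k=0}^{n} \binom{n}{k}^2 \binom{n+k}{k} \frac{x^k}{k!}$ for $n\ge 0$. There exist polynomials $c_{n,k}(x)\in\mathbb{Z}[x,n]$, $k=0,\dots,4$, such that $\sum_{k=0}^4 c_{n,k}(x) F_{n+k;2}^{(I)}(x)=0$ for all $n\ge 0$, and for $x=1$ these coefficients are $$c_{n,0}(1) = -(n + 1)^3(n + 2)(729n^4 + 7866n^3 + 31485n^2 + 55420n + 36204),$$ $$c_{n,1}(1) = (n + 2)(2916n^7 + 56979n^6 + 457068n^5 + 1963246n^4 + 4896596n^3 + 7111851n^2 + 5581516n + 1829348),$$ $$c_{n,2}(1) = -4374n^8 - 41364n^7 - 17307n^6 + 1312308n^5 + 7426532n^4 + 19463372n^3 + 27733489n^2 + 20769508n + 6413772,$$ $$c_{n,3}(1) = (n + 3)(2916n^7 + 56250n^6 + 443064n^5 + 1848631n^4 + 4411534n^3 + 6018161n^2 + 4343036n + 1278012),$$ $$c_{n,4}(1) = -(n + 3)(n + 4)^3(729n^4 + 4950n^3 + 12261n^2 + 13132n + 5132).$$ -}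

module Defs where

open import Data.Nat as ℕ using (ℕ; zero; suc; _!)
open import Data.Nat.Properties using (_!≢0)
open import Data.Nat.Combinatorics using (_C_)
open import Data.Integer as ℤ using (ℤ; +_)
open import Data.Rational using (ℚ; _+_; _*_; _/_; 0ℚ; 1ℚ)
open import Data.List using (List; []; _∷_)

_^ℚ_ : ℚ → ℕ → ℚ
x ^ℚ zero = 1ℚ
x ^ℚ suc k = x * (x ^ℚ k)

ℕ→ℚ : ℕ → ℚ
ℕ→ℚ k = (+ k) / 1

ℤ→ℚ : ℤ → ℚ
ℤ→ℚ z = z / 1

sumBelow : ℕ → (ℕ → ℚ) → ℚ
sumBelow zero    f = 0ℚ
sumBelow (suc m) f = sumBelow m f + f m

F : ℕ → ℚ → ℚ
F n x = sumBelow (suc n) (λ k →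
  ℕ→ℚ ((n C k) ℕ.* (n C k) ℕ.* ((n ℕ.+ k) C k))
    * (x ^ℚ k) * ((+ 1 / (k !)) {{k !≢0}}))

-- Polynomials in ℤ[x] as coefficient lists a₀ ∷ a₁ ∷ … (a₀ + a₁ x + …)
Poly : Set
Poly = List ℤ

-- Polynomials in ℤ[x, n] as lists of ℤ[x]-coefficients of powers of n:
-- p₀(x) ∷ p₁(x) ∷ … represents Σ_i p_i(x) n^i
BiPoly : Set
BiPoly = List Poly

evalPoly : Poly → ℚ → ℚ
evalPoly []       x = 0ℚ
evalPoly (a ∷ as) x = ℤ→ℚ a + x * evalPoly as x

evalBi : BiPoly → ℕ → ℚ → ℚ
evalBi []       n x = 0ℚ
evalBi (p ∷ ps) n x = evalPoly p x + ℕ→ℚ n * evalBi ps n x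

{-# OPTIONS --safe #-}
module Submission where

-- Creative telescoping. Write T(m, k) = C(m,k)² C(m+k,k) x^k / k! for the summands of F_m and
--   H(k) = x^k n! (n+k)! / (k!⁴ (n+4-k)!²).
-- For i ≤ 4 and k ≤ n+4 the factorials give T(n+i, k) = H(k) μᵢ(k), where
--   μᵢ(k) = (n+1)↑i · (n+k+1)↑i · ((n+4-k)↓(4-i))²
-- (rising and falling factorials), and H(k) x (n+k+1) (n+4-k)² = H(k+1) (k+1)⁴.
-- A certificate Q(n, k, x) satisfies the polynomial identity
--   Σᵢ cᵢ(n, x) μᵢ(k) = x (n+k+1) (n+4-k)² Q(n, k+1, x) - k⁴ Q(n, k, x),
-- so with G(k) = H(k) k⁴ Q(n, k, x) the combination Σᵢ cᵢ T(n+i, k) equals G(k+1) - G(k) for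
-- k < n+4 and -G(n+4) for k = n+4, where the factor (n+4-k)² vanishes. Summing over k ≤ n+4
-- leaves -G(0) = 0.

open import Defs
open import Data.Nat as ℕ using (ℕ; zero; suc; _!; _≤_; _<_; z≤n; s≤s)
open import Data.Nat.Properties as ℕ using (_!≢0)
open import Data.Nat.Combinatorics using (_C_; k>n⇒nCk≡0)
open import Data.List using (List; []; _∷_; map)
open import Data.Vec using (Vec; []; _∷_)
open import Data.Fin using (zero; suc)
open import Data.Maybe using (just; nothing)
open import Data.Product using (Σ; _×_; _,_)
open import Data.Sum using (inj₁; inj₂)
open import Function using (_∘_)
open import Relation.Binary.Definitions using (WeaklyDecidable)
open import Relation.Binary.PropositionalEquality
open import Relation.Nullary.Decidable using (yes; no)
open import Algebra.Solver.Ring.AlmostCommutativeRing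
  using (_-Raw-AlmostCommutative⟶_; fromCommutativeRing)
import Algebra.Solver.Ring

module Factorials where

  open import Data.Nat using (_+_; _*_; _^_; _∸_)
  open import Data.Nat.Properties
  open import Data.Nat.Combinatorics using (nCk≡n!/k![n-k]!; k![n∸k]!∣n!)
  open import Data.Nat.DivMod using (m/n*n≡m; _/_)
  open import Data.Nat.Solver using (module +-*-Solver)
  open +-*-Solver

  infixl 8 _↑_ _↓_

  _↑_ : ℕ → ℕ → ℕ
  m ↑ zero  = 1
  m ↑ suc i = m ↑ i * (m + i)

  _↓_ : ℕ → ℕ → ℕ
  m     ↓ zero  = 1
  zero  ↓ suc r = 0
  suc m ↓ suc r = suc m * m ↓ r

  [m+i]!≡m!*[1+m]↑i : ∀ m i → (m + i) ! ≡ m ! * suc m ↑ i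
  [m+i]!≡m!*[1+m]↑i m zero    = trans (cong _! (+-identityʳ m)) (sym (*-identityʳ (m !)))
  [m+i]!≡m!*[1+m]↑i m (suc i) = begin
    (m + suc i) !                    ≡⟨ cong _! (+-suc m i) ⟩
    suc (m + i) * (m + i) !          ≡⟨ cong (suc (m + i) *_) ([m+i]!≡m!*[1+m]↑i m i) ⟩
    suc (m + i) * (m ! * suc m ↑ i)  ≡⟨ solve 3 (λ a f r → a :* (f :* r) := f :* (r :* a))
                                              refl (suc (m + i)) (m !) (suc m ↑ i) ⟩
    m ! * suc m ↑ suc i              ∎
    where open ≡-Reasoning

  [r+l]!≡[r+l]↓r*l! : ∀ r l → (r + l) ! ≡ (r + l) ↓ r * l !
  [r+l]!≡[r+l]↓r*l! zero    l = sym (+-identityʳ (l !))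
  [r+l]!≡[r+l]↓r*l! (suc r) l = trans (cong (suc (r + l) *_) ([r+l]!≡[r+l]↓r*l! r l))
                                      (sym (*-assoc (suc (r + l)) ((r + l) ↓ r) (l !)))

  j<r⇒j↓r≡0 : ∀ {j r} → j < r → j ↓ r ≡ 0
  j<r⇒j↓r≡0 {zero}  {suc r} _         = refl
  j<r⇒j↓r≡0 {suc j} {suc r} (s≤s j<r) = trans (cong (suc j *_) (j<r⇒j↓r≡0 j<r)) (*-zeroʳ (suc j))

  [k+l]Ck*k!*l!≡[k+l]! : ∀ k l → ((k + l) C k) * (k ! * l !) ≡ (k + l) !
  [k+l]Ck*k!*l!≡[k+l]! k l = begin
    ((k + l) C k) * (k ! * l !)            ≡⟨ cong (λ z → ((k + l) C k) * (k ! * z !)) (sym (m+n∸m≡n k l)) ⟩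
    ((k + l) C k) * (k ! * (k + l ∸ k) !)  ≡⟨ cong (_* (k ! * (k + l ∸ k) !)) (nCk≡n!/k![n-k]! (m≤m+n k l)) ⟩
    (k + l) ! / (k ! * (k + l ∸ k) !) * (k ! * (k + l ∸ k) !)
                                           ≡⟨ m/n*n≡m (k![n∸k]!∣n! (m≤m+n k l)) ⟩
    (k + l) !                              ∎
    where
    open ≡-Reasoning
    instance _ = k !* (k + l ∸ k) !≢0

  apéry : ℕ → ℕ → ℕ
  apéry m k = (m C k) * (m C k) * ((m + k) C k)

  apéry-factorial : ∀ k l → apéry (k + l) k * ((k !) ^ 3 * (l !) ^ 2) ≡ (k + l) ! * (k + l + k) !
  apéry-factorial k l = *-cancelʳ-≡ _ _ (m !) {{m !≢0}} (begin
    apéry m k * ((k !) ^ 3 * (l !) ^ 2) * m !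
      ≡⟨ solve 5 (λ c c′ a b f → c :* c :* c′ :* (a :^ 3 :* b :^ 2) :* f
                              := (c :* (a :* b)) :* (c :* (a :* b)) :* (c′ :* (a :* f)))
               refl (m C k) ((m + k) C k) (k !) (l !) (m !) ⟩
    ((m C k) * (k ! * l !)) * ((m C k) * (k ! * l !)) * (((m + k) C k) * (k ! * m !))
      ≡⟨ cong₂ (λ a b → a * a * b) ([k+l]Ck*k!*l!≡[k+l]! k l) [m+k]Ck*k!*m!≡[m+k]! ⟩
    m ! * m ! * (m + k) !
      ≡⟨ solve 2 (λ a b → a :* a :* b := a :* b :* a) refl (m !) ((m + k) !) ⟩
    m ! * (m + k) ! * m ! ∎)
    where
    open ≡-Reasoning
    m = k + l
    [m+k]Ck*k!*m!≡[m+k]! : ((m + k) C k) * (k ! * m !) ≡ (m + k) !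
    [m+k]Ck*k!*m!≡[m+k]! = subst (λ z → (z C k) * (k ! * m !) ≡ z !) (+-comm k m) ([k+l]Ck*k!*l!≡[k+l]! k m)

  apéry-shift-≤ : ∀ n i s k l {j} → k + l ≡ n + i → j ≡ s + l →
    apéry (n + i) k * ((k !) ^ 3 * (j !) ^ 2) ≡ n ! * (n + k) ! * (suc n ↑ i * suc (n + k) ↑ i * (j ↓ s) ^ 2)
  apéry-shift-≤ n i s k l k+l≡n+i refl = begin
    apéry (n + i) k * ((k !) ^ 3 * ((s + l) !) ^ 2)
      ≡⟨ cong₂ (λ m f → apéry m k * ((k !) ^ 3 * f ^ 2)) (sym k+l≡n+i) ([r+l]!≡[r+l]↓r*l! s l) ⟩
    apéry (k + l) k * ((k !) ^ 3 * (f * l !) ^ 2)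
      ≡⟨ solve 4 (λ a b g h → a :* (b :^ 3 :* (g :* h) :^ 2) := a :* (b :^ 3 :* h :^ 2) :* g :^ 2)
               refl (apéry (k + l) k) (k !) f (l !) ⟩
    apéry (k + l) k * ((k !) ^ 3 * (l !) ^ 2) * f ^ 2
      ≡⟨ cong (_* f ^ 2) (apéry-factorial k l) ⟩
    (k + l) ! * (k + l + k) ! * f ^ 2
      ≡⟨ cong₂ (λ a b → a ! * b ! * f ^ 2) k+l≡n+i k+l+k≡n+k+i ⟩
    (n + i) ! * (n + k + i) ! * f ^ 2
      ≡⟨ cong₂ (λ a b → a * b * f ^ 2) ([m+i]!≡m!*[1+m]↑i n i) ([m+i]!≡m!*[1+m]↑i (n + k) i) ⟩
    n ! * suc n ↑ i * ((n + k) ! * suc (n + k) ↑ i) * f ^ 2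
      ≡⟨ solve 5 (λ a b c d e → a :* b :* (c :* d) :* e := a :* c :* (b :* d :* e))
               refl (n !) (suc n ↑ i) ((n + k) !) (suc (n + k) ↑ i) (f ^ 2) ⟩
    n ! * (n + k) ! * (suc n ↑ i * suc (n + k) ↑ i * f ^ 2) ∎
    where
    open ≡-Reasoning
    f = (s + l) ↓ s
    k+l+k≡n+k+i : k + l + k ≡ n + k + i
    k+l+k≡n+k+i = trans (cong (_+ k) k+l≡n+i) (solve 3 (λ n i k → n :+ i :+ k := n :+ k :+ i) refl n i k)

  apéry-shift : ∀ n i s k j → k + j ≡ n + i + s →
    apéry (n + i) k * ((k !) ^ 3 * (j !) ^ 2) ≡ n ! * (n + k) ! * (suc n ↑ i * suc (n + k) ↑ i * (j ↓ s) ^ 2)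
  apéry-shift n i s k j k+j≡n+i+s with k ≤? n + i
  ... | yes k≤n+i = apéry-shift-≤ n i s k l k+l≡n+i (+-cancelˡ-≡ k j (s + l) (begin
    k + j        ≡⟨ k+j≡n+i+s ⟩
    n + i + s    ≡⟨ cong (_+ s) k+l≡n+i ⟨
    k + l + s    ≡⟨ solve 3 (λ k l s → k :+ l :+ s := k :+ (s :+ l)) refl k l s ⟩
    k + (s + l)  ∎))
    where
    open ≡-Reasoning
    l = n + i ∸ k
    k+l≡n+i = m+[n∸m]≡n k≤n+i
  ... | no k≰n+i = begin
    apéry (n + i) k * ((k !) ^ 3 * (j !) ^ 2)
      ≡⟨ cong (λ c → c * c * ((n + i + k) C k) * ((k !) ^ 3 * (j !) ^ 2)) (k>n⇒nCk≡0 (≰⇒> k≰n+i)) ⟩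
    0
      ≡⟨ solve 2 (λ a b → con 0 := a :* (b :* con 0)) refl (n ! * (n + k) !) (suc n ↑ i * suc (n + k) ↑ i) ⟩
    n ! * (n + k) ! * (suc n ↑ i * suc (n + k) ↑ i * 0 ^ 2)
      ≡⟨ cong (λ z → n ! * (n + k) ! * (suc n ↑ i * suc (n + k) ↑ i * z ^ 2)) (sym (j<r⇒j↓r≡0 j<s)) ⟩
    n ! * (n + k) ! * (suc n ↑ i * suc (n + k) ↑ i * (j ↓ s) ^ 2) ∎
    where
    open ≡-Reasoning
    j<s : j < s
    j<s = +-cancelˡ-< (n + i) j s (subst (n + i + j <_) k+j≡n+i+s (+-monoˡ-< j (≰⇒> k≰n+i)))

  shiftFactor : ℕ → ℕ → ℕ → ℕ
  shiftFactor n i k = suc n ↑ i * suc (n + k) ↑ i * ((n + 4 ∸ k) ↓ (4 ∸ i)) ^ 2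

  apéry-shift-cross : ∀ n i k → i ≤ 4 → k ≤ n + 4 →
    apéry (n + i) k * ((k !) ^ 4 * ((n + 4 ∸ k) !) ^ 2) ≡ n ! * (n + k) ! * shiftFactor n i k * k !
  apéry-shift-cross n i k i≤4 k≤n+4 = begin
    apéry (n + i) k * ((k !) ^ 4 * (j !) ^ 2)
      ≡⟨ solve 3 (λ a f g → a :* (f :^ 4 :* g :^ 2) := a :* (f :^ 3 :* g :^ 2) :* f)
               refl (apéry (n + i) k) (k !) (j !) ⟩
    apéry (n + i) k * ((k !) ^ 3 * (j !) ^ 2) * k !
      ≡⟨ cong (_* k !) (apéry-shift n i (4 ∸ i) k j k+j≡n+i+[4-i]) ⟩
    n ! * (n + k) ! * shiftFactor n i k * k ! ∎
    where
    open ≡-Reasoning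
    j = n + 4 ∸ k
    k+j≡n+i+[4-i] : k + j ≡ n + i + (4 ∸ i)
    k+j≡n+i+[4-i] = begin
      k + j              ≡⟨ m+[n∸m]≡n k≤n+4 ⟩
      n + 4              ≡⟨ cong (n +_) (m+[n∸m]≡n i≤4) ⟨
      n + (i + (4 ∸ i))  ≡⟨ +-assoc n i (4 ∸ i) ⟨
      n + i + (4 ∸ i)    ∎

  kernel-step-cross : ∀ n k j →
    n ! * (n + k) ! * (suc (n + k) * suc j ^ 2) * ((suc k !) ^ 4 * (j !) ^ 2)
      ≡ n ! * (n + suc k) ! * suc k ^ 4 * ((k !) ^ 4 * (suc j !) ^ 2)
  kernel-step-cross n k j = begin
    n ! * (n + k) ! * (suc (n + k) * suc j ^ 2) * ((suc k !) ^ 4 * (j !) ^ 2)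
      ≡⟨ solve 7 (λ a b c d e f g → a :* b :* (c :* d :^ 2) :* ((e :* f) :^ 4 :* g :^ 2)
                                 := a :* (c :* b) :* e :^ 4 :* (f :^ 4 :* (d :* g) :^ 2))
               refl (n !) ((n + k) !) (suc (n + k)) (suc j) (suc k) (k !) (j !) ⟩
    n ! * (suc (n + k) * (n + k) !) * suc k ^ 4 * ((k !) ^ 4 * (suc j !) ^ 2)
      ≡⟨ cong (λ z → n ! * z ! * suc k ^ 4 * ((k !) ^ 4 * (suc j !) ^ 2)) (sym (+-suc n k)) ⟩
    n ! * (n + suc k) ! * suc k ^ 4 * ((k !) ^ 4 * (suc j !) ^ 2) ∎
    where open ≡-Reasoning

open Factorials

open import Data.Integer as ℤ using (ℤ; +_; -_; _+_; _-_; _*_)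
import Data.Integer.Properties as ℤ
open import Data.Rational as ℚ using (ℚ; 0ℚ; 1ℚ; _/_; toℚᵘ)
  renaming (_+_ to _+ℚ_; _*_ to _*ℚ_; _-_ to _-ℚ_)
import Data.Rational.Properties as ℚ
open import Data.Rational.Unnormalised as ℚᵘ using (mkℚᵘ; *≡*)
import Data.Rational.Unnormalised.Properties as ℚᵘ

ℤ→ℚ-homo-+ : ∀ a b → ℤ→ℚ (a + b) ≡ ℤ→ℚ a +ℚ ℤ→ℚ b
ℤ→ℚ-homo-+ a b = ℚ.toℚᵘ-injective (begin
  toℚᵘ (ℤ→ℚ (a + b))                ≈⟨ ℚ.toℚᵘ-fromℚᵘ (mkℚᵘ (a + b) 0) ⟩
  mkℚᵘ (a + b) 0
    ≈⟨ *≡* (cong (_* + 1) (sym (cong₂ _+_ (ℤ.*-identityʳ a) (ℤ.*-identityʳ b)))) ⟩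
  mkℚᵘ a 0 ℚᵘ.+ mkℚᵘ b 0             ≈⟨ ℚᵘ.+-cong (ℚ.toℚᵘ-fromℚᵘ (mkℚᵘ a 0)) (ℚ.toℚᵘ-fromℚᵘ (mkℚᵘ b 0)) ⟨
  toℚᵘ (ℤ→ℚ a) ℚᵘ.+ toℚᵘ (ℤ→ℚ b)   ≈⟨ ℚ.toℚᵘ-homo-+ (ℤ→ℚ a) (ℤ→ℚ b) ⟨
  toℚᵘ (ℤ→ℚ a +ℚ ℤ→ℚ b)             ∎)
  where open ℚᵘ.≃-Reasoning

ℤ→ℚ-homo-* : ∀ a b → ℤ→ℚ (a * b) ≡ ℤ→ℚ a *ℚ ℤ→ℚ b
ℤ→ℚ-homo-* a b = ℚ.toℚᵘ-injective (begin
  toℚᵘ (ℤ→ℚ (a * b))                ≈⟨ ℚ.toℚᵘ-fromℚᵘ (mkℚᵘ (a * b) 0) ⟩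
  mkℚᵘ a 0 ℚᵘ.* mkℚᵘ b 0             ≈⟨ ℚᵘ.*-cong (ℚ.toℚᵘ-fromℚᵘ (mkℚᵘ a 0)) (ℚ.toℚᵘ-fromℚᵘ (mkℚᵘ b 0)) ⟨
  toℚᵘ (ℤ→ℚ a) ℚᵘ.* toℚᵘ (ℤ→ℚ b)   ≈⟨ ℚ.toℚᵘ-homo-* (ℤ→ℚ a) (ℤ→ℚ b) ⟨
  toℚᵘ (ℤ→ℚ a *ℚ ℤ→ℚ b)             ∎)
  where open ℚᵘ.≃-Reasoning

ℤ→ℚ-homo‿- : ∀ a → ℤ→ℚ (- a) ≡ ℚ.- ℤ→ℚ a
ℤ→ℚ-homo‿- a = ℚ.toℚᵘ-injective (begin
  toℚᵘ (ℤ→ℚ (- a))     ≈⟨ ℚ.toℚᵘ-fromℚᵘ (mkℚᵘ (- a) 0) ⟩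
  ℚᵘ.- mkℚᵘ a 0         ≈⟨ ℚᵘ.-‿cong (ℚ.toℚᵘ-fromℚᵘ (mkℚᵘ a 0)) ⟨
  ℚᵘ.- toℚᵘ (ℤ→ℚ a)    ≈⟨ ℚ.toℚᵘ-homo‿- (ℤ→ℚ a) ⟨
  toℚᵘ (ℚ.- ℤ→ℚ a)     ∎)
  where open ℚᵘ.≃-Reasoning

ℤ→ℚ-morphism : ℤ.+-*-rawRing -Raw-AlmostCommutative⟶ fromCommutativeRing ℚ.+-*-commutativeRing
ℤ→ℚ-morphism = record
  { ⟦_⟧    = ℤ→ℚ
  ; +-homo = ℤ→ℚ-homo-+
  ; *-homo = ℤ→ℚ-homo-*
  ; -‿homo = ℤ→ℚ-homo‿-
  ; 0-homo = refl
  ; 1-homo = refl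
  }

ℤ→ℚ-≟ : WeaklyDecidable (λ a b → ℤ→ℚ a ≡ ℤ→ℚ b)
ℤ→ℚ-≟ a b with a ℤ.≟ b
... | yes a≡b = just (cong ℤ→ℚ a≡b)
... | no  _   = nothing

-- Integer coefficients keep the normal forms cheap: the certificate identity below is
-- checked by evaluating them, which would be hopeless with gcd-normalised rationals.
module ℤℚ-Solver = Algebra.Solver.Ring ℤ.+-*-rawRing (fromCommutativeRing ℚ.+-*-commutativeRing)
                                        ℤ→ℚ-morphism ℤ→ℚ-≟
open ℤℚ-Solver
  using (Polynomial; con; var; _:^_; :-_; _:+_; _:*_; _:-_; ⟦_⟧; ⟦_⟧↓; prove; solve; _:=_)

ℕ→ℚ-homo-+ : ∀ a b → ℕ→ℚ (a ℕ.+ b) ≡ ℕ→ℚ a +ℚ ℕ→ℚ b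
ℕ→ℚ-homo-+ a b = trans (cong ℤ→ℚ (ℤ.pos-+ a b)) (ℤ→ℚ-homo-+ (+ a) (+ b))

ℕ→ℚ-homo-* : ∀ a b → ℕ→ℚ (a ℕ.* b) ≡ ℕ→ℚ a *ℚ ℕ→ℚ b
ℕ→ℚ-homo-* a b = trans (cong ℤ→ℚ (ℤ.pos-* a b)) (ℤ→ℚ-homo-* (+ a) (+ b))

ℕ→ℚ-homo-^ : ∀ a e → ℕ→ℚ (a ℕ.^ e) ≡ ℕ→ℚ a ^ℚ e
ℕ→ℚ-homo-^ a zero    = refl
ℕ→ℚ-homo-^ a (suc e) = trans (ℕ→ℚ-homo-* a (a ℕ.^ e)) (cong (ℕ→ℚ a *ℚ_) (ℕ→ℚ-homo-^ a e))

ℕ→ℚ-homo-∸ : ∀ {m k} → k ≤ m → ℕ→ℚ (m ℕ.∸ k) ≡ ℕ→ℚ m -ℚ ℕ→ℚ k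
ℕ→ℚ-homo-∸ {m} {k} k≤m = begin
  ℕ→ℚ (m ℕ.∸ k)                     ≡⟨ solve 2 (λ a b → a := a :+ b :- b) refl (ℕ→ℚ (m ℕ.∸ k)) (ℕ→ℚ k) ⟩
  ℕ→ℚ (m ℕ.∸ k) +ℚ ℕ→ℚ k -ℚ ℕ→ℚ k  ≡⟨ cong (_-ℚ ℕ→ℚ k) (ℕ→ℚ-homo-+ (m ℕ.∸ k) k) ⟨
  ℕ→ℚ (m ℕ.∸ k ℕ.+ k) -ℚ ℕ→ℚ k      ≡⟨ cong (λ z → ℕ→ℚ z -ℚ ℕ→ℚ k) (ℕ.m∸n+n≡m k≤m) ⟩
  ℕ→ℚ m -ℚ ℕ→ℚ k                    ∎
  where open ≡-Reasoning

/-cross : ∀ a b c d .{{_ : ℕ.NonZero b}} .{{_ : ℕ.NonZero d}} → a ℕ.* d ≡ c ℕ.* b → + a / b ≡ + c / d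
/-cross a (suc b) c (suc d) eq = ℚ.fromℚᵘ-cong {mkℚᵘ (+ a) b} {mkℚᵘ (+ c) d}
  (*≡* (trans (sym (ℤ.pos-* a (suc d))) (trans (cong +_ eq) (ℤ.pos-* c (suc b)))))

/-*-ℕ→ℚ : ∀ a b c .{{_ : ℕ.NonZero b}} → (+ a / b) *ℚ ℕ→ℚ c ≡ + (a ℕ.* c) / b
/-*-ℕ→ℚ a (suc b) c = ℚ.toℚᵘ-injective (begin
  toℚᵘ ((+ a / suc b) *ℚ ℕ→ℚ c)           ≈⟨ ℚ.toℚᵘ-homo-* (+ a / suc b) (ℕ→ℚ c) ⟩
  toℚᵘ (+ a / suc b) ℚᵘ.* toℚᵘ (ℕ→ℚ c)
    ≈⟨ ℚᵘ.*-cong (ℚ.toℚᵘ-fromℚᵘ (mkℚᵘ (+ a) b)) (ℚ.toℚᵘ-fromℚᵘ (mkℚᵘ (+ c) 0)) ⟩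
  mkℚᵘ (+ a) b ℚᵘ.* mkℚᵘ (+ c) 0
    ≈⟨ *≡* (cong₂ _*_ (sym (ℤ.pos-* a c)) (cong +_ (sym (ℕ.*-identityʳ (suc b))))) ⟩
  mkℚᵘ (+ (a ℕ.* c)) b                     ≈⟨ ℚ.toℚᵘ-fromℚᵘ (mkℚᵘ (+ (a ℕ.* c)) b) ⟨
  toℚᵘ (+ (a ℕ.* c) / suc b)              ∎)
  where open ℚᵘ.≃-Reasoning

hornerᵖ : ∀ {v} → Polynomial v → List (Polynomial v) → Polynomial v
hornerᵖ y []       = con (+ 0)
hornerᵖ y (p ∷ ps) = p :+ y :* hornerᵖ y ps

polyᵖ : ∀ {v} → Polynomial v → Poly → Polynomial v
polyᵖ x = hornerᵖ x ∘ map con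

biPolyᵖ : ∀ {v} → (n x : Polynomial v) → BiPoly → Polynomial v
biPolyᵖ n x = hornerᵖ n ∘ map (polyᵖ x)

⟦polyᵖ⟧ : ∀ {v} (x : Polynomial v) ρ p → ⟦ polyᵖ x p ⟧ ρ ≡ evalPoly p (⟦ x ⟧ ρ)
⟦polyᵖ⟧ x ρ []      = refl
⟦polyᵖ⟧ x ρ (a ∷ p) = cong (λ z → ℤ→ℚ a +ℚ ⟦ x ⟧ ρ *ℚ z) (⟦polyᵖ⟧ x ρ p)

⟦biPolyᵖ⟧ : ∀ {v} (n x : Polynomial v) ρ {m} → ⟦ n ⟧ ρ ≡ ℕ→ℚ m →
            ∀ c → ⟦ biPolyᵖ n x c ⟧ ρ ≡ evalBi c m (⟦ x ⟧ ρ)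
⟦biPolyᵖ⟧ n x ρ n≡m []      = refl
⟦biPolyᵖ⟧ n x ρ n≡m (p ∷ c) = cong₂ _+ℚ_ (⟦polyᵖ⟧ x ρ p) (cong₂ _*ℚ_ n≡m (⟦biPolyᵖ⟧ n x ρ n≡m c))

risingᵖ : ∀ {v} → Polynomial v → ℕ → Polynomial v
risingᵖ y zero    = con (+ 1)
risingᵖ y (suc i) = risingᵖ y i :* (y :+ con (+ i))

fallingᵖ : ∀ {v} → Polynomial v → ℕ → Polynomial v
fallingᵖ y zero    = con (+ 1)
fallingᵖ y (suc r) = y :* fallingᵖ (y :- con (+ 1)) r

⟦risingᵖ⟧ : ∀ {v} (y : Polynomial v) ρ {m} → ⟦ y ⟧ ρ ≡ ℕ→ℚ m → ∀ i → ⟦ risingᵖ y i ⟧ ρ ≡ ℕ→ℚ (m ↑ i)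
⟦risingᵖ⟧ y ρ     y≡m zero    = refl
⟦risingᵖ⟧ y ρ {m} y≡m (suc i) = begin
  ⟦ risingᵖ y i ⟧ ρ *ℚ (⟦ y ⟧ ρ +ℚ ℕ→ℚ i)  ≡⟨ cong₂ (λ a b → a *ℚ (b +ℚ ℕ→ℚ i)) (⟦risingᵖ⟧ y ρ y≡m i) y≡m ⟩
  ℕ→ℚ (m ↑ i) *ℚ (ℕ→ℚ m +ℚ ℕ→ℚ i)        ≡⟨ cong (ℕ→ℚ (m ↑ i) *ℚ_) (ℕ→ℚ-homo-+ m i) ⟨
  ℕ→ℚ (m ↑ i) *ℚ ℕ→ℚ (m ℕ.+ i)           ≡⟨ ℕ→ℚ-homo-* (m ↑ i) (m ℕ.+ i) ⟨
  ℕ→ℚ (m ↑ suc i)                         ∎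
  where open ≡-Reasoning

⟦fallingᵖ⟧ : ∀ {v} (y : Polynomial v) ρ {m} → ⟦ y ⟧ ρ ≡ ℕ→ℚ m → ∀ r → ⟦ fallingᵖ y r ⟧ ρ ≡ ℕ→ℚ (m ↓ r)
⟦fallingᵖ⟧ y ρ         y≡m zero    = refl
⟦fallingᵖ⟧ y ρ {zero}  y≡m (suc r) = trans (cong (_*ℚ rest) y≡m) (ℚ.*-zeroˡ rest)
  where rest = ⟦ fallingᵖ (y :- con (+ 1)) r ⟧ ρ
⟦fallingᵖ⟧ y ρ {suc m} y≡m (suc r) = begin
  ⟦ y ⟧ ρ *ℚ ⟦ fallingᵖ (y :- con (+ 1)) r ⟧ ρ  ≡⟨ cong₂ _*ℚ_ y≡m (⟦fallingᵖ⟧ (y :- con (+ 1)) ρ y-1≡m r) ⟩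
  ℕ→ℚ (suc m) *ℚ ℕ→ℚ (m ↓ r)                   ≡⟨ ℕ→ℚ-homo-* (suc m) (m ↓ r) ⟨
  ℕ→ℚ (suc m ↓ suc r)                          ∎
  where
  open ≡-Reasoning
  y-1≡m : ⟦ y :- con (+ 1) ⟧ ρ ≡ ℕ→ℚ m
  y-1≡m = begin
    ⟦ y ⟧ ρ -ℚ 1ℚ       ≡⟨ cong (_-ℚ 1ℚ) (trans y≡m (ℕ→ℚ-homo-+ 1 m)) ⟩
    1ℚ +ℚ ℕ→ℚ m -ℚ 1ℚ  ≡⟨ solve 1 (λ a → con (+ 1) :+ a :- con (+ 1) := a) refl (ℕ→ℚ m) ⟩
    ℕ→ℚ m              ∎

evalCert : List BiPoly → ℕ → ℚ → ℚ → ℚ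
evalCert []       n k x = 0ℚ
evalCert (q ∷ qs) n k x = evalBi q n x +ℚ k *ℚ evalCert qs n k x

certᵖ : ∀ {v} → (n k x : Polynomial v) → List BiPoly → Polynomial v
certᵖ n k x = hornerᵖ k ∘ map (biPolyᵖ n x)

c0 : BiPoly
c0 = (- + 103896 ∷ + 31488 ∷ [])
   ∷ (- + 508620 ∷ + 144352 ∷ [])
   ∷ (- + 1050162 ∷ + 273416 ∷ [])
   ∷ (- + 1192491 ∷ + 276564 ∷ [])
   ∷ (- + 814305 ∷ + 161116 ∷ [])
   ∷ (- + 342834 ∷ + 54092 ∷ [])
   ∷ (- + 87084 ∷ + 9708 ∷ [])
   ∷ (- + 12231 ∷ + 720 ∷ [])
   ∷ (- + 729 ∷ [])
   ∷ []

c1 : BiPoly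
c1 = (+ 1301760 ∷ + 3536424 ∷ - + 1179488 ∷ [])
   ∷ (+ 5173104 ∷ + 11269340 ∷ - + 3450064 ∷ [])
   ∷ (+ 8839428 ∷ + 15101062 ∷ - + 4135272 ∷ [])
   ∷ (+ 8477694 ∷ + 11025969 ∷ - + 2598620 ∷ [])
   ∷ (+ 4989612 ∷ + 4736180 ∷ - + 902704 ∷ [])
   ∷ (+ 1845096 ∷ + 1196602 ∷ - + 164316 ∷ [])
   ∷ (+ 418644 ∷ + 164622 ∷ - + 12240 ∷ [])
   ∷ (+ 53298 ∷ + 9513 ∷ [])
   ∷ (+ 2916 ∷ [])
   ∷ []

c2 : BiPoly
c2 = (- + 4006620 ∷ + 17208192 ∷ - + 7361800 ∷ + 574000 ∷ [])
   ∷ (- + 14489244 ∷ + 54208992 ∷ - + 20331840 ∷ + 1381600 ∷ [])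
   ∷ (- + 22505715 ∷ + 71845152 ∷ - + 22902508 ∷ + 1296560 ∷ [])
   ∷ (- + 19626372 ∷ + 51978264 ∷ - + 13481544 ∷ + 593024 ∷ [])
   ∷ (- + 10519776 ∷ + 22193592 ∷ - + 4379572 ∷ + 132288 ∷ [])
   ∷ (- + 3552156 ∷ + 5598336 ∷ - + 745392 ∷ + 11520 ∷ [])
   ∷ (- + 738531 ∷ + 773208 ∷ - + 51984 ∷ [])
   ∷ (- + 86508 ∷ + 45144 ∷ [])
   ∷ (- + 4374 ∷ [])
   ∷ []

c3 : BiPoly
c3 = (+ 4573620 ∷ + 459096 ∷ - + 1198680 ∷ [])
   ∷ (+ 15605112 ∷ + 1854656 ∷ - + 3152648 ∷ [])
   ∷ (+ 22791489 ∷ + 2964934 ∷ - + 3358904 ∷ [])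
   ∷ (+ 18631593 ∷ + 2478954 ∷ - + 1857784 ∷ [])
   ∷ (+ 9336765 ∷ + 1184390 ∷ - + 563728 ∷ [])
   ∷ (+ 2941089 ∷ + 325918 ∷ - + 89184 ∷ [])
   ∷ (+ 569466 ∷ + 48108 ∷ - + 5760 ∷ [])
   ∷ (+ 62046 ∷ + 2952 ∷ [])
   ∷ (+ 2916 ∷ [])
   ∷ []

c4 : BiPoly
c4 = (- + 1764864 ∷ + 779520 ∷ [])
   ∷ (- + 5780352 ∷ + 2191552 ∷ [])
   ∷ (- + 8075040 ∷ + 2558384 ∷ [])
   ∷ (- + 6290424 ∷ + 1609668 ∷ [])
   ∷ (- + 2992296 ∷ + 590692 ∷ [])
   ∷ (- + 891195 ∷ + 126716 ∷ [])
   ∷ (- + 162495 ∷ + 14748 ∷ [])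
   ∷ (- + 16605 ∷ + 720 ∷ [])
   ∷ (- + 729 ∷ [])
   ∷ []

-- The creative-telescoping certificate Q(n, k, x) = Σ_b q_b(n, x) k^b, each q_b stored like the cᵢ.
certificate : List BiPoly
certificate =
    ((+ 1096406784 ∷ - + 418660032 ∷ + 18368000 ∷ [])
     ∷ (+ 6334216608 ∷ - + 2303454928 ∷ + 99315200 ∷ [])
     ∷ (+ 16472949144 ∷ - + 5641476968 ∷ + 234967520 ∷ [])
     ∷ (+ 25518560616 ∷ - + 8122024008 ∷ + 320318128 ∷ [])
     ∷ (+ 26242671900 ∷ - + 7640736952 ∷ + 278711680 ∷ [])
     ∷ (+ 18884662143 ∷ - + 4933835528 ∷ + 161799712 ∷ [])
     ∷ (+ 9756245439 ∷ - + 2232473268 ∷ + 63499040 ∷ [])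
     ∷ (+ 3647809395 ∷ - + 708191016 ∷ + 16645232 ∷ [])
     ∷ (+ 980154855 ∷ - + 154426800 ∷ + 2791040 ∷ [])
     ∷ (+ 184668093 ∷ - + 22056696 ∷ + 270528 ∷ [])
     ∷ (+ 23168349 ∷ - + 1858140 ∷ + 11520 ∷ [])
     ∷ (+ 1738665 ∷ - + 69984 ∷ [])
     ∷ (+ 59049 ∷ [])
     ∷ [])
  ∷ ((- + 348406560 ∷ + 54196944 ∷ + 9184000 ∷ [])
     ∷ (- + 1954344240 ∷ + 348795480 ∷ + 33585600 ∷ [])
     ∷ (- + 4888243548 ∷ + 947188296 ∷ + 48376960 ∷ [])
     ∷ (- + 7198688790 ∷ + 1446459960 ∷ + 32549584 ∷ [])
     ∷ (- + 6937627248 ∷ + 1386638496 ∷ + 6495088 ∷ [])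
     ∷ (- + 4596172200 ∷ + 876919140 ∷ - + 5034320 ∷ [])
     ∷ (- + 2136959406 ∷ + 372090108 ∷ - + 4031280 ∷ [])
     ∷ (- + 697669110 ∷ + 104949228 ∷ - + 1254464 ∷ [])
     ∷ (- + 156833496 ∷ + 18881388 ∷ - + 189888 ∷ [])
     ∷ (- + 23133600 ∷ + 1960848 ∷ - + 11520 ∷ [])
     ∷ (- + 2016414 ∷ + 89424 ∷ [])
     ∷ (- + 78732 ∷ [])
     ∷ [])
  ∷ ((+ 47805480 ∷ + 16658496 ∷ - + 8036000 ∷ [])
     ∷ (+ 258590676 ∷ + 61281200 ∷ - + 32544400 ∷ [])
     ∷ (+ 615716574 ∷ + 88484680 ∷ - + 55668640 ∷ [])
     ∷ (+ 849700377 ∷ + 58778712 ∷ - + 52513216 ∷ [])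
     ∷ (+ 752739321 ∷ + 9731492 ∷ - + 29838784 ∷ [])
     ∷ (+ 447490806 ∷ - + 11631980 ∷ - + 10430704 ∷ [])
     ∷ (+ 180912006 ∷ - + 8816964 ∷ - + 2180864 ∷ [])
     ∷ (+ 49152861 ∷ - + 2774940 ∷ - + 247488 ∷ [])
     ∷ (+ 8596773 ∷ - + 431928 ∷ - + 11520 ∷ [])
     ∷ (+ 874800 ∷ - + 27216 ∷ [])
     ∷ (+ 39366 ∷ [])
     ∷ [])
  ∷ ((- + 3379680 ∷ - + 2802768 ∷ + 1148000 ∷ [])
     ∷ (- + 17478432 ∷ - + 11158200 ∷ + 4485200 ∷ [])
     ∷ (- + 39084732 ∷ - + 18697104 ∷ + 7311920 ∷ [])
     ∷ (- + 49568238 ∷ - + 17215932 ∷ + 6457328 ∷ [])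
     ∷ (- + 39293334 ∷ - + 9513012 ∷ + 3340208 ∷ [])
     ∷ (- + 20205828 ∷ - + 3219180 ∷ + 1012928 ∷ [])
     ∷ (- + 6748092 ∷ - + 647244 ∷ + 166848 ∷ [])
     ∷ (- + 1413234 ∷ - + 69840 ∷ + 11520 ∷ [])
     ∷ (- + 168642 ∷ - + 3024 ∷ [])
     ∷ (- + 8748 ∷ [])
     ∷ [])
  ∷ ((+ 103896 ∷ - + 31488 ∷ [])
     ∷ (+ 508620 ∷ - + 144352 ∷ [])
     ∷ (+ 1050162 ∷ - + 273416 ∷ [])
     ∷ (+ 1192491 ∷ - + 276564 ∷ [])
     ∷ (+ 814305 ∷ - + 161116 ∷ [])
     ∷ (+ 342834 ∷ - + 54092 ∷ [])
     ∷ (+ 87084 ∷ - + 9708 ∷ [])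
     ∷ (+ 12231 ∷ - + 720 ∷ [])
     ∷ (+ 729 ∷ [])
     ∷ [])
  ∷ []


recurrence : ℕ → ℚ → (ℕ → ℚ) → ℚ
recurrence n x f = evalBi c0 n x *ℚ f 0 +ℚ evalBi c1 n x *ℚ f 1 +ℚ evalBi c2 n x *ℚ f 2
                 +ℚ evalBi c3 n x *ℚ f 3 +ℚ evalBi c4 n x *ℚ f 4

n̂ : ∀ {v} → Polynomial (suc v)
n̂ = var zero

k̂ x̂ : Polynomial 3
k̂ = var (suc zero)
x̂ = var (suc (suc zero))

shiftFactorᵖ : ℕ → Polynomial 3
shiftFactorᵖ i = risingᵖ (con (+ 1) :+ n̂) i :* risingᵖ (con (+ 1) :+ (n̂ :+ k̂)) i
               :* fallingᵖ (n̂ :+ con (+ 4) :- k̂) (4 ℕ.∸ i) :^ 2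

stepFactorᵖ : Polynomial 3
stepFactorᵖ = x̂ :* ((con (+ 1) :+ (n̂ :+ k̂)) :* (n̂ :+ con (+ 4) :- k̂) :^ 2)

certificate-identity : ∀ n k x → let ρ = ℕ→ℚ n ∷ k ∷ x ∷ [] in
  recurrence n x (λ i → ⟦ shiftFactorᵖ i ⟧ ρ)
    ≡ ⟦ stepFactorᵖ ⟧ ρ *ℚ evalCert certificate n (1ℚ +ℚ k) x -ℚ k ^ℚ 4 *ℚ evalCert certificate n k x
certificate-identity n k x = prove (ℕ→ℚ n ∷ k ∷ x ∷ [])
  (biPolyᵖ n̂ x̂ c0 :* shiftFactorᵖ 0 :+ biPolyᵖ n̂ x̂ c1 :* shiftFactorᵖ 1
    :+ biPolyᵖ n̂ x̂ c2 :* shiftFactorᵖ 2 :+ biPolyᵖ n̂ x̂ c3 :* shiftFactorᵖ 3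
    :+ biPolyᵖ n̂ x̂ c4 :* shiftFactorᵖ 4)
  (stepFactorᵖ :* certᵖ n̂ (con (+ 1) :+ k̂) x̂ certificate :- k̂ :^ 4 :* certᵖ n̂ k̂ x̂ certificate)
  refl

recurrence-cong : ∀ n x {f g : ℕ → ℚ} → (∀ {i} → i ≤ 4 → f i ≡ g i) → recurrence n x f ≡ recurrence n x g
recurrence-cong n x f≡g =
  cong₂ _+ℚ_ (cong₂ _+ℚ_ (cong₂ _+ℚ_ (cong₂ _+ℚ_
    (cong (evalBi c0 n x *ℚ_) (f≡g z≤n))
    (cong (evalBi c1 n x *ℚ_) (f≡g (s≤s z≤n))))
    (cong (evalBi c2 n x *ℚ_) (f≡g (s≤s (s≤s z≤n)))))
    (cong (evalBi c3 n x *ℚ_) (f≡g (s≤s (s≤s (s≤s z≤n))))))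
    (cong (evalBi c4 n x *ℚ_) (f≡g (s≤s (s≤s (s≤s (s≤s z≤n))))))

recurrence-0 : ∀ n x → recurrence n x (λ _ → 0ℚ) ≡ 0ℚ
recurrence-0 n x = solve 5
  (λ a b c d e → a :* con (+ 0) :+ b :* con (+ 0) :+ c :* con (+ 0) :+ d :* con (+ 0) :+ e :* con (+ 0)
              := con (+ 0))
  refl (evalBi c0 n x) (evalBi c1 n x) (evalBi c2 n x) (evalBi c3 n x) (evalBi c4 n x)

recurrence-+ : ∀ n x f g → recurrence n x f +ℚ recurrence n x g ≡ recurrence n x (λ i → f i +ℚ g i)
recurrence-+ n x f g = solve 15
  (λ a b c d e f₀ f₁ f₂ f₃ f₄ g₀ g₁ g₂ g₃ g₄ →
      (a :* f₀ :+ b :* f₁ :+ c :* f₂ :+ d :* f₃ :+ e :* f₄)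
      :+ (a :* g₀ :+ b :* g₁ :+ c :* g₂ :+ d :* g₃ :+ e :* g₄)
   := a :* (f₀ :+ g₀) :+ b :* (f₁ :+ g₁) :+ c :* (f₂ :+ g₂) :+ d :* (f₃ :+ g₃) :+ e :* (f₄ :+ g₄))
  refl (evalBi c0 n x) (evalBi c1 n x) (evalBi c2 n x) (evalBi c3 n x) (evalBi c4 n x)
       (f 0) (f 1) (f 2) (f 3) (f 4) (g 0) (g 1) (g 2) (g 3) (g 4)

recurrence-*ˡ : ∀ n x h f → recurrence n x (λ i → h *ℚ f i) ≡ h *ℚ recurrence n x f
recurrence-*ˡ n x h f = solve 11
  (λ a b c d e h f₀ f₁ f₂ f₃ f₄ →
      a :* (h :* f₀) :+ b :* (h :* f₁) :+ c :* (h :* f₂) :+ d :* (h :* f₃) :+ e :* (h :* f₄)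
   := h :* (a :* f₀ :+ b :* f₁ :+ c :* f₂ :+ d :* f₃ :+ e :* f₄))
  refl (evalBi c0 n x) (evalBi c1 n x) (evalBi c2 n x) (evalBi c3 n x) (evalBi c4 n x)
       h (f 0) (f 1) (f 2) (f 3) (f 4)

sumBelow-recurrence : ∀ n x (f : ℕ → ℕ → ℚ) N →
  sumBelow N (λ k → recurrence n x (λ i → f i k)) ≡ recurrence n x (λ i → sumBelow N (f i))
sumBelow-recurrence n x f zero    = sym (recurrence-0 n x)
sumBelow-recurrence n x f (suc N) =
  trans (cong (_+ℚ recurrence n x (λ i → f i N)) (sumBelow-recurrence n x f N))
        (recurrence-+ n x (λ i → sumBelow N (f i)) (λ i → f i N))

sumBelow-telescope : ∀ (f g : ℕ → ℚ) N → (∀ k → k < N → f k ≡ g (suc k) -ℚ g k) →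
                     sumBelow N f ≡ g N -ℚ g 0
sumBelow-telescope f g zero    _     = sym (ℚ.+-inverseʳ (g 0))
sumBelow-telescope f g (suc N) f≡Δg = begin
  sumBelow N f +ℚ f N
    ≡⟨ cong₂ _+ℚ_ (sumBelow-telescope f g N (λ k k<N → f≡Δg k (ℕ.m<n⇒m<1+n k<N))) (f≡Δg N (ℕ.n<1+n N)) ⟩
  g N -ℚ g 0 +ℚ (g (suc N) -ℚ g N)
    ≡⟨ solve 3 (λ a b c → b :- a :+ (c :- b) := c :- a) refl (g 0) (g N) (g (suc N)) ⟩
  g (suc N) -ℚ g 0 ∎
  where open ≡-Reasoning

sumBelow-extend : ∀ f {m} M → m ≤ M → (∀ k → m ≤ k → f k ≡ 0ℚ) → sumBelow M f ≡ sumBelow m f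
sumBelow-extend f zero    z≤n   _   = refl
sumBelow-extend f (suc M) m≤1+M f≡0 with ℕ.m≤n⇒m<n∨m≡n m≤1+M
... | inj₂ refl      = refl
... | inj₁ (s≤s m≤M) = trans (cong₂ _+ℚ_ (sumBelow-extend f M m≤M f≡0) (f≡0 M m≤M)) (ℚ.+-identityʳ _)

summand : ℕ → ℚ → ℕ → ℚ
summand m x k = ℕ→ℚ (apéry m k) *ℚ x ^ℚ k *ℚ (+ 1 / k !)
  where instance _ = k !≢0

summand-vanishes : ∀ m x k → m < k → summand m x k ≡ 0ℚ
summand-vanishes m x k m<k = begin
  ℕ→ℚ ((m C k) ℕ.* (m C k) ℕ.* ((m ℕ.+ k) C k)) *ℚ x ^ℚ k *ℚ (+ 1 / k !)
    ≡⟨ cong (λ c → ℕ→ℚ (c ℕ.* c ℕ.* ((m ℕ.+ k) C k)) *ℚ x ^ℚ k *ℚ (+ 1 / k !)) (k>n⇒nCk≡0 m<k) ⟩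
  0ℚ *ℚ x ^ℚ k *ℚ (+ 1 / k !)
    ≡⟨ solve 2 (λ a b → con (+ 0) :* a :* b := con (+ 0)) refl (x ^ℚ k) (+ 1 / k !) ⟩
  0ℚ ∎
  where
  open ≡-Reasoning
  instance _ = k !≢0

F≡sumBelow : ∀ m x N → m < N → F m x ≡ sumBelow N (summand m x)
F≡sumBelow m x N m<N = sym (sumBelow-extend (summand m x) N m<N (summand-vanishes m x))

summand-fraction : ∀ m x k → summand m x k ≡ x ^ℚ k *ℚ (+ apéry m k / k !) {{k !≢0}}
summand-fraction m x k = begin
  ℕ→ℚ (apéry m k) *ℚ x ^ℚ k *ℚ (+ 1 / k !)
    ≡⟨ solve 3 (λ a y u → a :* y :* u := y :* (u :* a)) refl (ℕ→ℚ (apéry m k)) (x ^ℚ k) (+ 1 / k !) ⟩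
  x ^ℚ k *ℚ ((+ 1 / k !) *ℚ ℕ→ℚ (apéry m k))
    ≡⟨ cong (x ^ℚ k *ℚ_) (/-*-ℕ→ℚ 1 (k !) (apéry m k)) ⟩
  x ^ℚ k *ℚ (+ (1 ℕ.* apéry m k) / k !)
    ≡⟨ cong (λ a → x ^ℚ k *ℚ (+ a / k !)) (ℕ.*-identityˡ (apéry m k)) ⟩
  x ^ℚ k *ℚ (+ apéry m k / k !) ∎
  where
  open ≡-Reasoning
  instance _ = k !≢0

module Kernel (n : ℕ) (x : ℚ) where

  denominator : ℕ → ℕ
  denominator k = (k !) ℕ.^ 4 ℕ.* ((n ℕ.+ 4 ℕ.∸ k) !) ℕ.^ 2

  denominator≢0 : ∀ k → ℕ.NonZero (denominator k)
  denominator≢0 k = ℕ.m*n≢0 _ _ {{ℕ.m^n≢0 (k !) 4 {{k !≢0}}}} {{ℕ.m^n≢0 (j !) 2 {{j !≢0}}}}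
    where j = n ℕ.+ 4 ℕ.∸ k

  kernel : ℕ → ℚ
  kernel k = x ^ℚ k *ℚ (+ (n ! ℕ.* (n ℕ.+ k) !) / denominator k)
    where instance _ = denominator≢0 k

  stepFactor : ℕ → ℚ
  stepFactor k = x *ℚ ℕ→ℚ (suc (n ℕ.+ k) ℕ.* (n ℕ.+ 4 ℕ.∸ k) ℕ.^ 2)

  summand≡kernel*shiftFactor : ∀ i k → i ≤ 4 → k ≤ n ℕ.+ 4 →
                               summand (n ℕ.+ i) x k ≡ kernel k *ℚ ℕ→ℚ (shiftFactor n i k)
  summand≡kernel*shiftFactor i k i≤4 k≤n+4 = begin
    summand (n ℕ.+ i) x k
      ≡⟨ summand-fraction (n ℕ.+ i) x k ⟩
    X *ℚ (+ apéry (n ℕ.+ i) k / k !)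
      ≡⟨ cong (X *ℚ_) (/-cross (apéry (n ℕ.+ i) k) (k !) (N ℕ.* μ) (denominator k)
                               (apéry-shift-cross n i k i≤4 k≤n+4)) ⟩
    X *ℚ (+ (N ℕ.* μ) / denominator k)
      ≡⟨ cong (X *ℚ_) (/-*-ℕ→ℚ N (denominator k) μ) ⟨
    X *ℚ ((+ N / denominator k) *ℚ ℕ→ℚ μ)
      ≡⟨ ℚ.*-assoc X (+ N / denominator k) (ℕ→ℚ μ) ⟨
    kernel k *ℚ ℕ→ℚ μ ∎
    where
    open ≡-Reasoning
    X = x ^ℚ k
    N = n ! ℕ.* (n ℕ.+ k) !
    μ = shiftFactor n i k
    instance _ = k !≢0
             _ = denominator≢0 k

  kernel-step : ∀ k → k < n ℕ.+ 4 → kernel k *ℚ stepFactor k ≡ kernel (suc k) *ℚ ℕ→ℚ (suc k) ^ℚ 4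
  kernel-step k k<n+4 = begin
    x ^ℚ k *ℚ (+ N k / D k) *ℚ (x *ℚ ℕ→ℚ r)
      ≡⟨ solve 4 (λ y h z s → y :* h :* (z :* s) := z :* y :* (h :* s)) refl (x ^ℚ k) (+ N k / D k) x (ℕ→ℚ r) ⟩
    X′ *ℚ ((+ N k / D k) *ℚ ℕ→ℚ r)
      ≡⟨ cong (X′ *ℚ_) (/-*-ℕ→ℚ (N k) (D k) r) ⟩
    X′ *ℚ (+ (N k ℕ.* r) / D k)
      ≡⟨ cong (X′ *ℚ_) (/-cross (N k ℕ.* r) (D k) (N (suc k) ℕ.* suc k ℕ.^ 4) (D (suc k)) cross) ⟩
    X′ *ℚ (+ (N (suc k) ℕ.* suc k ℕ.^ 4) / D (suc k))
      ≡⟨ cong (X′ *ℚ_) (/-*-ℕ→ℚ (N (suc k)) (D (suc k)) (suc k ℕ.^ 4)) ⟨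
    X′ *ℚ ((+ N (suc k) / D (suc k)) *ℚ ℕ→ℚ (suc k ℕ.^ 4))
      ≡⟨ ℚ.*-assoc X′ (+ N (suc k) / D (suc k)) (ℕ→ℚ (suc k ℕ.^ 4)) ⟨
    kernel (suc k) *ℚ ℕ→ℚ (suc k ℕ.^ 4)
      ≡⟨ cong (kernel (suc k) *ℚ_) (ℕ→ℚ-homo-^ (suc k) 4) ⟩
    kernel (suc k) *ℚ ℕ→ℚ (suc k) ^ℚ 4 ∎
    where
    open ≡-Reasoning
    instance _ = denominator≢0 k
             _ = denominator≢0 (suc k)
    X′ = x ^ℚ suc k
    D = denominator
    N : ℕ → ℕ
    N k = n ! ℕ.* (n ℕ.+ k) !
    r = suc (n ℕ.+ k) ℕ.* (n ℕ.+ 4 ℕ.∸ k) ℕ.^ 2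
    n+4∸k≡1+n+4∸[1+k] : n ℕ.+ 4 ℕ.∸ k ≡ suc (n ℕ.+ 4 ℕ.∸ suc k)
    n+4∸k≡1+n+4∸[1+k] = ℕ.+-∸-assoc 1 k<n+4
    cross : N k ℕ.* r ℕ.* D (suc k) ≡ N (suc k) ℕ.* suc k ℕ.^ 4 ℕ.* D k
    cross rewrite n+4∸k≡1+n+4∸[1+k] = kernel-step-cross n k (n ℕ.+ 4 ℕ.∸ suc k)

  module _ {k} (k≤n+4 : k ≤ n ℕ.+ 4) where

    private
      ρ : Vec ℚ 3
      ρ = ℕ→ℚ n ∷ ℕ→ℚ k ∷ x ∷ []

      ⟦1+n⟧ : ⟦ con (+ 1) :+ n̂ ⟧ ρ ≡ ℕ→ℚ (suc n)
      ⟦1+n⟧ = sym (ℕ→ℚ-homo-+ 1 n)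

      ⟦1+n+k⟧ : ⟦ con (+ 1) :+ (n̂ :+ k̂) ⟧ ρ ≡ ℕ→ℚ (suc (n ℕ.+ k))
      ⟦1+n+k⟧ = trans (cong (λ z → 1ℚ +ℚ z) (sym (ℕ→ℚ-homo-+ n k))) (sym (ℕ→ℚ-homo-+ 1 (n ℕ.+ k)))

      ⟦n+4-k⟧ : ⟦ n̂ :+ con (+ 4) :- k̂ ⟧ ρ ≡ ℕ→ℚ (n ℕ.+ 4 ℕ.∸ k)
      ⟦n+4-k⟧ = sym (trans (ℕ→ℚ-homo-∸ k≤n+4) (cong (_-ℚ ℕ→ℚ k) (ℕ→ℚ-homo-+ n 4)))

    ⟦shiftFactorᵖ⟧ : ∀ i → ⟦ shiftFactorᵖ i ⟧ ρ ≡ ℕ→ℚ (shiftFactor n i k)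
    ⟦shiftFactorᵖ⟧ i = begin
      ⟦ risingᵖ (con (+ 1) :+ n̂) i ⟧ ρ *ℚ ⟦ risingᵖ (con (+ 1) :+ (n̂ :+ k̂)) i ⟧ ρ
        *ℚ ⟦ fallingᵖ (n̂ :+ con (+ 4) :- k̂) (4 ℕ.∸ i) ⟧ ρ ^ℚ 2
        ≡⟨ cong₂ (λ a b → a *ℚ b ^ℚ 2)
                 (cong₂ _*ℚ_ (⟦risingᵖ⟧ (con (+ 1) :+ n̂) ρ ⟦1+n⟧ i)
                             (⟦risingᵖ⟧ (con (+ 1) :+ (n̂ :+ k̂)) ρ ⟦1+n+k⟧ i))
                 (⟦fallingᵖ⟧ (n̂ :+ con (+ 4) :- k̂) ρ ⟦n+4-k⟧ (4 ℕ.∸ i)) ⟩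
      ℕ→ℚ (suc n ↑ i) *ℚ ℕ→ℚ (suc (n ℕ.+ k) ↑ i) *ℚ ℕ→ℚ f ^ℚ 2
        ≡⟨ cong₂ _*ℚ_ (ℕ→ℚ-homo-* (suc n ↑ i) (suc (n ℕ.+ k) ↑ i)) (ℕ→ℚ-homo-^ f 2) ⟨
      ℕ→ℚ (suc n ↑ i ℕ.* suc (n ℕ.+ k) ↑ i) *ℚ ℕ→ℚ (f ℕ.^ 2)
        ≡⟨ ℕ→ℚ-homo-* (suc n ↑ i ℕ.* suc (n ℕ.+ k) ↑ i) (f ℕ.^ 2) ⟨
      ℕ→ℚ (shiftFactor n i k) ∎
      where
      open ≡-Reasoning
      f = (n ℕ.+ 4 ℕ.∸ k) ↓ (4 ℕ.∸ i)

    ⟦stepFactorᵖ⟧ : ⟦ stepFactorᵖ ⟧ ρ ≡ stepFactor k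
    ⟦stepFactorᵖ⟧ = cong (x *ℚ_) (begin
      ⟦ con (+ 1) :+ (n̂ :+ k̂) ⟧ ρ *ℚ ⟦ n̂ :+ con (+ 4) :- k̂ ⟧ ρ ^ℚ 2
        ≡⟨ cong₂ (λ a b → a *ℚ b ^ℚ 2) ⟦1+n+k⟧ ⟦n+4-k⟧ ⟩
      ℕ→ℚ (suc (n ℕ.+ k)) *ℚ ℕ→ℚ (n ℕ.+ 4 ℕ.∸ k) ^ℚ 2
        ≡⟨ cong (ℕ→ℚ (suc (n ℕ.+ k)) *ℚ_) (ℕ→ℚ-homo-^ (n ℕ.+ 4 ℕ.∸ k) 2) ⟨
      ℕ→ℚ (suc (n ℕ.+ k)) *ℚ ℕ→ℚ ((n ℕ.+ 4 ℕ.∸ k) ℕ.^ 2)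
        ≡⟨ ℕ→ℚ-homo-* (suc (n ℕ.+ k)) ((n ℕ.+ 4 ℕ.∸ k) ℕ.^ 2) ⟨
      ℕ→ℚ (suc (n ℕ.+ k) ℕ.* (n ℕ.+ 4 ℕ.∸ k) ℕ.^ 2) ∎)
      where open ≡-Reasoning

module Telescoping (n : ℕ) (x : ℚ) where

  open Kernel n x

  Q : ℕ → ℚ
  Q k = evalCert certificate n (ℕ→ℚ k) x

  combination : ℕ → ℚ
  combination k = recurrence n x (λ i → summand (n ℕ.+ i) x k)

  antidifference : ℕ → ℚ
  antidifference k = kernel k *ℚ (ℕ→ℚ k ^ℚ 4 *ℚ Q k)

  combination-certificate : ∀ k → k ≤ n ℕ.+ 4 →
                            combination k ≡ kernel k *ℚ stepFactor k *ℚ Q (suc k) -ℚ antidifference k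
  combination-certificate k k≤n+4 = begin
    recurrence n x (λ i → summand (n ℕ.+ i) x k)
      ≡⟨ recurrence-cong n x (λ {i} i≤4 → summand≡kernel*shiftFactor i k i≤4 k≤n+4) ⟩
    recurrence n x (λ i → kernel k *ℚ ℕ→ℚ (shiftFactor n i k))
      ≡⟨ recurrence-*ˡ n x (kernel k) (λ i → ℕ→ℚ (shiftFactor n i k)) ⟩
    kernel k *ℚ recurrence n x (λ i → ℕ→ℚ (shiftFactor n i k))
      ≡⟨ cong (kernel k *ℚ_) (recurrence-cong n x (λ {i} _ → sym (⟦shiftFactorᵖ⟧ k≤n+4 i))) ⟩
    kernel k *ℚ recurrence n x (λ i → ⟦ shiftFactorᵖ i ⟧ ρ)
      ≡⟨ cong (kernel k *ℚ_) (certificate-identity n (ℕ→ℚ k) x) ⟩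
    kernel k *ℚ (⟦ stepFactorᵖ ⟧ ρ *ℚ evalCert certificate n (1ℚ +ℚ ℕ→ℚ k) x -ℚ K⁴ *ℚ Q k)
      ≡⟨ cong₂ (λ s q → kernel k *ℚ (s *ℚ q -ℚ K⁴ *ℚ Q k))
               (⟦stepFactorᵖ⟧ k≤n+4) (cong (λ z → evalCert certificate n z x) (sym (ℕ→ℚ-homo-+ 1 k))) ⟩
    kernel k *ℚ (stepFactor k *ℚ Q (suc k) -ℚ K⁴ *ℚ Q k)
      ≡⟨ solve 5 (λ h s q′ a q → h :* (s :* q′ :- a :* q) := h :* s :* q′ :- h :* (a :* q))
               refl (kernel k) (stepFactor k) (Q (suc k)) K⁴ (Q k) ⟩
    kernel k *ℚ stepFactor k *ℚ Q (suc k) -ℚ antidifference k ∎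
    where
    open ≡-Reasoning
    ρ = ℕ→ℚ n ∷ ℕ→ℚ k ∷ x ∷ []
    K⁴ = ℕ→ℚ k ^ℚ 4

  combination-telescopes : ∀ k → k < n ℕ.+ 4 → combination k ≡ antidifference (suc k) -ℚ antidifference k
  combination-telescopes k k<n+4 = begin
    combination k
      ≡⟨ combination-certificate k (ℕ.<⇒≤ k<n+4) ⟩
    kernel k *ℚ stepFactor k *ℚ Q (suc k) -ℚ antidifference k
      ≡⟨ cong (λ z → z *ℚ Q (suc k) -ℚ antidifference k) (kernel-step k k<n+4) ⟩
    kernel (suc k) *ℚ ℕ→ℚ (suc k) ^ℚ 4 *ℚ Q (suc k) -ℚ antidifference k
      ≡⟨ cong (_-ℚ antidifference k) (ℚ.*-assoc (kernel (suc k)) (ℕ→ℚ (suc k) ^ℚ 4) (Q (suc k))) ⟩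
    antidifference (suc k) -ℚ antidifference k ∎
    where open ≡-Reasoning

  stepFactor-last : stepFactor (n ℕ.+ 4) ≡ 0ℚ
  stepFactor-last = begin
    x *ℚ ℕ→ℚ (a ℕ.* (n ℕ.+ 4 ℕ.∸ (n ℕ.+ 4)) ℕ.^ 2)
      ≡⟨ cong (λ z → x *ℚ ℕ→ℚ (a ℕ.* z ℕ.^ 2)) (ℕ.n∸n≡0 (n ℕ.+ 4)) ⟩
    x *ℚ ℕ→ℚ (a ℕ.* 0)
      ≡⟨ cong (λ z → x *ℚ ℕ→ℚ z) (ℕ.*-zeroʳ a) ⟩
    x *ℚ 0ℚ
      ≡⟨ ℚ.*-zeroʳ x ⟩
    0ℚ ∎
    where
    open ≡-Reasoning
    a = suc (n ℕ.+ (n ℕ.+ 4))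

  combination-last : combination (n ℕ.+ 4) ≡ ℚ.- antidifference (n ℕ.+ 4)
  combination-last = begin
    combination (n ℕ.+ 4)
      ≡⟨ combination-certificate (n ℕ.+ 4) ℕ.≤-refl ⟩
    kernel (n ℕ.+ 4) *ℚ stepFactor (n ℕ.+ 4) *ℚ Q (suc (n ℕ.+ 4)) -ℚ G
      ≡⟨ cong (λ s → kernel (n ℕ.+ 4) *ℚ s *ℚ Q (suc (n ℕ.+ 4)) -ℚ G) stepFactor-last ⟩
    kernel (n ℕ.+ 4) *ℚ 0ℚ *ℚ Q (suc (n ℕ.+ 4)) -ℚ G
      ≡⟨ solve 3 (λ h q g → h :* con (+ 0) :* q :- g := :- g) refl (kernel (n ℕ.+ 4)) (Q (suc (n ℕ.+ 4))) G ⟩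
    ℚ.- G ∎
    where
    open ≡-Reasoning
    G = antidifference (n ℕ.+ 4)

  antidifference-0 : antidifference 0 ≡ 0ℚ
  antidifference-0 = solve 2 (λ h q → h :* (con (+ 0) :^ 4 :* q) := con (+ 0)) refl (kernel 0) (Q 0)

  sum-combination : sumBelow (suc (n ℕ.+ 4)) combination ≡ 0ℚ
  sum-combination = begin
    sumBelow (n ℕ.+ 4) combination +ℚ combination (n ℕ.+ 4)
      ≡⟨ cong₂ _+ℚ_ (sumBelow-telescope combination antidifference (n ℕ.+ 4) combination-telescopes)
                    combination-last ⟩
    G -ℚ antidifference 0 +ℚ ℚ.- G
      ≡⟨ cong (λ z → G -ℚ z +ℚ ℚ.- G) antidifference-0 ⟩
    G -ℚ 0ℚ +ℚ ℚ.- G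
      ≡⟨ solve 1 (λ g → g :- con (+ 0) :+ :- g := con (+ 0)) refl G ⟩
    0ℚ ∎
    where
    open ≡-Reasoning
    G = antidifference (n ℕ.+ 4)

-- The i = 0 case is kept apart because n + 0 does not reduce to n.
F[_+_] : ℕ → ℕ → ℚ → ℚ
F[ n + zero  ] x = F n x
F[ n + suc i ] x = F (n ℕ.+ suc i) x

F[n+i]≡sumBelow : ∀ n x i → i ≤ 4 → F[ n + i ] x ≡ sumBelow (suc (n ℕ.+ 4)) (summand (n ℕ.+ i) x)
F[n+i]≡sumBelow n x zero    _   =
  trans (F≡sumBelow n x (suc (n ℕ.+ 4)) (s≤s (ℕ.m≤m+n n 4)))
        (cong (λ m → sumBelow (suc (n ℕ.+ 4)) (summand m x)) (sym (ℕ.+-identityʳ n)))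
F[n+i]≡sumBelow n x (suc i) i≤4 = F≡sumBelow (n ℕ.+ suc i) x (suc (n ℕ.+ 4)) (s≤s (ℕ.+-monoʳ-≤ n i≤4))

recurrence-holds : ∀ n x → recurrence n x (λ i → F[ n + i ] x) ≡ 0ℚ
recurrence-holds n x = begin
  recurrence n x (λ i → F[ n + i ] x)
    ≡⟨ recurrence-cong n x (λ {i} i≤4 → F[n+i]≡sumBelow n x i i≤4) ⟩
  recurrence n x (λ i → sumBelow (suc (n ℕ.+ 4)) (summand (n ℕ.+ i) x))
    ≡⟨ sumBelow-recurrence n x (λ i → summand (n ℕ.+ i) x) (suc (n ℕ.+ 4)) ⟨
  sumBelow (suc (n ℕ.+ 4)) (Telescoping.combination n x)
    ≡⟨ Telescoping.sum-combination n x ⟩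
  0ℚ ∎
  where open ≡-Reasoning

infixl 6 _+⇓_ _-⇓_
infixl 7 _*⇓_
infix  8 -⇓_

-- A relation rather than an evaluation function: its index is then literally the integer
-- expression of the statement, so matching the two needs no ℤ arithmetic on an open n.
data Evaluates (n : ℕ) : Polynomial 1 → ℤ → Set where
  n⇓ : Evaluates n n̂ (+ n)
  c⇓ : ∀ m → Evaluates n (con (+ m)) (+ m)
  _+⇓_ : ∀ {p q x y} → Evaluates n p x → Evaluates n q y → Evaluates n (p :+ q) (x + y)
  _-⇓_ : ∀ {p q x y} → Evaluates n p x → Evaluates n q y → Evaluates n (p :- q) (x - y)
  _*⇓_ : ∀ {p q x y} → Evaluates n p x → Evaluates n q y → Evaluates n (p :* q) (x * y)
  -⇓_  : ∀ {p x} → Evaluates n p x → Evaluates n (:- p) (- x)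

Evaluates-sound : ∀ {n p z} → Evaluates n p z → ℤ→ℚ z ≡ ⟦ p ⟧ (ℕ→ℚ n ∷ [])
Evaluates-sound n⇓                       = refl
Evaluates-sound (c⇓ m)                   = refl
Evaluates-sound (_+⇓_ {x = x} {y} p⇓ q⇓) =
  trans (ℤ→ℚ-homo-+ x y) (cong₂ _+ℚ_ (Evaluates-sound p⇓) (Evaluates-sound q⇓))
Evaluates-sound (_-⇓_ {x = x} {y} p⇓ q⇓) =
  trans (ℤ→ℚ-homo-+ x (- y)) (cong₂ _+ℚ_ (Evaluates-sound p⇓) (Evaluates-sound (-⇓ q⇓)))
Evaluates-sound (_*⇓_ {x = x} {y} p⇓ q⇓) =
  trans (ℤ→ℚ-homo-* x y) (cong₂ _*ℚ_ (Evaluates-sound p⇓) (Evaluates-sound q⇓))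
Evaluates-sound (-⇓_ {x = x} p⇓)         = trans (ℤ→ℚ-homo‿- x) (cong ℚ.-_ (Evaluates-sound p⇓))

evalBi-at-1 : ∀ c n {p z} → Evaluates n p z →
              ⟦ biPolyᵖ n̂ (con (+ 1)) c ⟧↓ (ℕ→ℚ n ∷ []) ≡ ⟦ p ⟧↓ (ℕ→ℚ n ∷ []) →
              evalBi c n 1ℚ ≡ ℤ→ℚ z
evalBi-at-1 c n {p} {z} p⇓z normal-forms-agree = begin
  evalBi c n 1ℚ                               ≡⟨ ⟦biPolyᵖ⟧ n̂ (con (+ 1)) ρ refl c ⟨
  ⟦ biPolyᵖ n̂ (con (+ 1)) c ⟧ ρ              ≡⟨ prove ρ (biPolyᵖ n̂ (con (+ 1)) c) p normal-forms-agree ⟩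
  ⟦ p ⟧ ρ                                     ≡⟨ Evaluates-sound p⇓z ⟨
  ℤ→ℚ z                                       ∎
  where
  open ≡-Reasoning
  ρ = ℕ→ℚ n ∷ []

proposition2p7 : Σ BiPoly λ c0 → Σ BiPoly λ c1 → Σ BiPoly λ c2 → Σ BiPoly λ c3 → Σ BiPoly λ c4 →
  ((n : ℕ) (x : ℚ) →
    evalBi c0 n x *ℚ F n x +ℚ evalBi c1 n x *ℚ F (ℕ._+_ n 1) x
      +ℚ evalBi c2 n x *ℚ F (ℕ._+_ n 2) x +ℚ evalBi c3 n x *ℚ F (ℕ._+_ n 3) x
      +ℚ evalBi c4 n x *ℚ F (ℕ._+_ n 4) x ≡ 0ℚ)
  × ((n : ℕ) → evalBi c0 n 1ℚ ≡ ℤ→ℚ (- ((+ n + + 1) * (+ n + + 1) * (+ n + + 1) * (+ n + + 2)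
      * (+ 729 * (+ n * + n * + n * + n) + + 7866 * (+ n * + n * + n) + + 31485 * (+ n * + n) + + 55420 * + n + + 36204))))
  × ((n : ℕ) → evalBi c1 n 1ℚ ≡ ℤ→ℚ ((+ n + + 2)
      * (+ 2916 * (+ n * + n * + n * + n * + n * + n * + n) + + 56979 * (+ n * + n * + n * + n * + n * + n)
         + + 457068 * (+ n * + n * + n * + n * + n) + + 1963246 * (+ n * + n * + n * + n)
         + + 4896596 * (+ n * + n * + n) + + 7111851 * (+ n * + n) + + 5581516 * + n + + 1829348)))
  × ((n : ℕ) → evalBi c2 n 1ℚ ≡ ℤ→ℚ (- (+ 4374 * (+ n * + n * + n * + n * + n * + n * + n * + n))
      - + 41364 * (+ n * + n * + n * + n * + n * + n * + n) - + 17307 * (+ n * + n * + n * + n * + n * + n)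
      + + 1312308 * (+ n * + n * + n * + n * + n) + + 7426532 * (+ n * + n * + n * + n)
      + + 19463372 * (+ n * + n * + n) + + 27733489 * (+ n * + n) + + 20769508 * + n + + 6413772))
  × ((n : ℕ) → evalBi c3 n 1ℚ ≡ ℤ→ℚ ((+ n + + 3)
      * (+ 2916 * (+ n * + n * + n * + n * + n * + n * + n) + + 56250 * (+ n * + n * + n * + n * + n * + n)
         + + 443064 * (+ n * + n * + n * + n * + n) + + 1848631 * (+ n * + n * + n * + n)
         + + 4411534 * (+ n * + n * + n) + + 6018161 * (+ n * + n) + + 4343036 * + n + + 1278012)))
  × ((n : ℕ) → evalBi c4 n 1ℚ ≡ ℤ→ℚ (- ((+ n + + 3) * (+ n + + 4) * (+ n + + 4) * (+ n + + 4)
      * (+ 729 * (+ n * + n * + n * + n) + + 4950 * (+ n * + n * + n) + + 12261 * (+ n * + n) + + 13132 * + n + + 5132))))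
proposition2p7 =
  c0 , c1 , c2 , c3 , c4 ,
  recurrence-holds ,
  (λ n → evalBi-at-1 c0 n
     (-⇓ ((n⇓ +⇓ c⇓ 1) *⇓ (n⇓ +⇓ c⇓ 1) *⇓ (n⇓ +⇓ c⇓ 1) *⇓ (n⇓ +⇓ c⇓ 2)
      *⇓ (c⇓ 729 *⇓ (n⇓ *⇓ n⇓ *⇓ n⇓ *⇓ n⇓) +⇓ c⇓ 7866 *⇓ (n⇓ *⇓ n⇓ *⇓ n⇓) +⇓ c⇓ 31485 *⇓ (n⇓ *⇓ n⇓)
      +⇓ c⇓ 55420 *⇓ n⇓ +⇓ c⇓ 36204)))
     refl) ,
  (λ n → evalBi-at-1 c1 n
     ((n⇓ +⇓ c⇓ 2)
      *⇓ (c⇓ 2916 *⇓ (n⇓ *⇓ n⇓ *⇓ n⇓ *⇓ n⇓ *⇓ n⇓ *⇓ n⇓ *⇓ n⇓)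
      +⇓ c⇓ 56979 *⇓ (n⇓ *⇓ n⇓ *⇓ n⇓ *⇓ n⇓ *⇓ n⇓ *⇓ n⇓)
      +⇓ c⇓ 457068 *⇓ (n⇓ *⇓ n⇓ *⇓ n⇓ *⇓ n⇓ *⇓ n⇓) +⇓ c⇓ 1963246 *⇓ (n⇓ *⇓ n⇓ *⇓ n⇓ *⇓ n⇓)
      +⇓ c⇓ 4896596 *⇓ (n⇓ *⇓ n⇓ *⇓ n⇓) +⇓ c⇓ 7111851 *⇓ (n⇓ *⇓ n⇓) +⇓ c⇓ 5581516 *⇓ n⇓ +⇓ c⇓ 1829348))
     refl) ,
  (λ n → evalBi-at-1 c2 n
     (-⇓ (c⇓ 4374 *⇓ (n⇓ *⇓ n⇓ *⇓ n⇓ *⇓ n⇓ *⇓ n⇓ *⇓ n⇓ *⇓ n⇓ *⇓ n⇓))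
      -⇓ c⇓ 41364 *⇓ (n⇓ *⇓ n⇓ *⇓ n⇓ *⇓ n⇓ *⇓ n⇓ *⇓ n⇓ *⇓ n⇓)
      -⇓ c⇓ 17307 *⇓ (n⇓ *⇓ n⇓ *⇓ n⇓ *⇓ n⇓ *⇓ n⇓ *⇓ n⇓)
      +⇓ c⇓ 1312308 *⇓ (n⇓ *⇓ n⇓ *⇓ n⇓ *⇓ n⇓ *⇓ n⇓) +⇓ c⇓ 7426532 *⇓ (n⇓ *⇓ n⇓ *⇓ n⇓ *⇓ n⇓)
      +⇓ c⇓ 19463372 *⇓ (n⇓ *⇓ n⇓ *⇓ n⇓) +⇓ c⇓ 27733489 *⇓ (n⇓ *⇓ n⇓) +⇓ c⇓ 20769508 *⇓ n⇓ +⇓ c⇓ 6413772)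
     refl) ,
  (λ n → evalBi-at-1 c3 n
     ((n⇓ +⇓ c⇓ 3)
      *⇓ (c⇓ 2916 *⇓ (n⇓ *⇓ n⇓ *⇓ n⇓ *⇓ n⇓ *⇓ n⇓ *⇓ n⇓ *⇓ n⇓)
      +⇓ c⇓ 56250 *⇓ (n⇓ *⇓ n⇓ *⇓ n⇓ *⇓ n⇓ *⇓ n⇓ *⇓ n⇓)
      +⇓ c⇓ 443064 *⇓ (n⇓ *⇓ n⇓ *⇓ n⇓ *⇓ n⇓ *⇓ n⇓) +⇓ c⇓ 1848631 *⇓ (n⇓ *⇓ n⇓ *⇓ n⇓ *⇓ n⇓)
      +⇓ c⇓ 4411534 *⇓ (n⇓ *⇓ n⇓ *⇓ n⇓) +⇓ c⇓ 6018161 *⇓ (n⇓ *⇓ n⇓) +⇓ c⇓ 4343036 *⇓ n⇓ +⇓ c⇓ 1278012))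
     refl) ,
  (λ n → evalBi-at-1 c4 n
     (-⇓ ((n⇓ +⇓ c⇓ 3) *⇓ (n⇓ +⇓ c⇓ 4) *⇓ (n⇓ +⇓ c⇓ 4) *⇓ (n⇓ +⇓ c⇓ 4)
      *⇓ (c⇓ 729 *⇓ (n⇓ *⇓ n⇓ *⇓ n⇓ *⇓ n⇓) +⇓ c⇓ 4950 *⇓ (n⇓ *⇓ n⇓ *⇓ n⇓) +⇓ c⇓ 12261 *⇓ (n⇓ *⇓ n⇓)
      +⇓ c⇓ 13132 *⇓ n⇓ +⇓ c⇓ 5132)))
     refl)
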